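{- Let $w,v\in\Sigma^\ast$ with $\mathrm{alph}(w)=\mathrm{alph}(v)$, and let $I\subseteq E(G(w,v))$ be a set of pairwise independent (i.e. pairwise vertex-disjoint) edges. Then there exist $1$-uniform words $u_w,u_v\in\Sigma^\ast$ with $\mathrm{alph}(u_w)=\mathrm{alph}(u_v)=\mathrm{alph}(w)$ such that $E(G(wu_w,vu_v))=E(G(w,v))\setminus I$.
   Context: $\Sigma$ is a finite alphabet. For a word $w$, $\mathrm{alph}(w)$ is the set of letters occurring in $w$ and $|w|_a$ the number of occurrences of $a$; a word $u$ is $1$-uniform if $|u|_a=1$ for every $a\in\mathrm{alph}(u)$. For letters $a,b$, $\pi_{a,b}$ is the monoid morphism on $\Sigma^\ast$ with $a\mapsto a$, $b\mapsto b$ and all other letters mapped to the empty word. For words $w,v$ with $\mathrm{alph}(w)=\mathrm{alph}(v)=A$, $G(w,v)$ is the undirected simple graph on vertex set $A$ in which distinct $a,b$ are adjacent iff $\pi_{a,b}(w)=\pi_{a,b}(v)$; $E(\cdot)$ denotes the edge set. -}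

module Defs where

open import Data.Nat using (ℕ)
open import Data.Fin using (Fin; _≟_)
open import Data.List using (List; []; _∷_; filter; length; _++_)
open import Data.List.Membership.Propositional using (_∈_)
open import Data.List.Relation.Unary.AllPairs using (AllPairs)
open import Data.Product using (_×_; _,_; Σ)
open import Data.Sum using (_⊎_)
open import Relation.Nullary using (¬_)
open import Relation.Nullary.Decidable using (_⊎-dec_)
open import Relation.Binary.PropositionalEquality using (_≡_)

Word : ℕ → Set
Word n = List (Fin n)

count : ∀ {n} → Fin n → Word n → ℕ
count a w = length (filter (_≟ a) w)

-- a ∈ alph(w) is expressed as a ∈ w (list membership).
SameAlph : ∀ {n} → Word n → Word n → Set
SameAlph w v = ∀ a → (a ∈ w → a ∈ v) × (a ∈ v → a ∈ w)

OneUniform : ∀ {n} → Word n → Set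
OneUniform u = ∀ a → a ∈ u → count a u ≡ 1

proj : ∀ {n} → Fin n → Fin n → Word n → Word n
proj a b w = filter (λ x → (x ≟ a) ⊎-dec (x ≟ b)) w

Edge : ∀ {n} → Word n → Word n → Fin n → Fin n → Set
Edge w v a b = a ∈ w × b ∈ w × ¬ (a ≡ b) × proj a b w ≡ proj a b v

-- a set I of (unordered) edges represented by a list of pairs;
-- {a,b} ∈ I
InI : ∀ {n} → List (Fin n × Fin n) → Fin n → Fin n → Set
InI I a b = ((a , b) ∈ I) ⊎ ((b , a) ∈ I)

Disjoint : ∀ {n} → Fin n × Fin n → Fin n × Fin n → Set
Disjoint (a , b) (c , d) = ¬ (a ≡ c) × ¬ (a ≡ d) × ¬ (b ≡ c) × ¬ (b ≡ d)

IndependentEdgeSet : ∀ {n} → Word n → Word n → List (Fin n × Fin n) → Set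
IndependentEdgeSet w v I =
  (∀ a b → (a , b) ∈ I → Edge w v a b) × AllPairs Disjoint I

{-# OPTIONS --safe #-}
module Submission where

-- For I = {a₁b₁, …, a_kb_k} take u_w = a₁b₁⋯a_kb_k r and u_v = b₁a₁⋯b_ka_k r, where r
-- lists the letters of w not covered by I, once each. As u_v is a permutation of u_w,
-- π_{x,y}(u_w) and π_{x,y}(u_v) have equal length, so π_{x,y}(w u_w) = π_{x,y}(v u_v)
-- splits into π_{x,y}(w) = π_{x,y}(v) and π_{x,y}(u_w) = π_{x,y}(u_v). Because the edges
-- of I are disjoint, π_{x,y} keeps both letters of a block a_ib_i only if {x,y} = {a_i,b_i};
-- so the last equation fails exactly when {x,y} ∈ I.

open import Defs
open import Data.Nat using (ℕ; _+_)
open import Data.Nat.Properties using (+-cancelʳ-≡; suc-injective)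
open import Data.Fin using (Fin; _≟_)
open import Data.List using (List; []; _∷_; _++_; filter; length; map; deduplicate)
open import Data.List.Properties using (filter-accept; filter-reject; filter-none; filter-++; length-++; ∷-injective; ∷-injectiveˡ)
open import Data.List.Membership.Propositional using (_∈_)
open import Data.List.Membership.Propositional.Properties using (∈-filter⁻; ∈-filter⁺; ∈-++⁻; ∈-++⁺ˡ; ∈-++⁺ʳ; ∈-deduplicate⁻; ∈-deduplicate⁺)
import Data.List.Membership.DecPropositional as DecMembership
open import Data.List.Relation.Binary.Subset.Propositional using (_⊆_)
open import Data.List.Relation.Binary.Permutation.Propositional using (_↭_; ↭-refl; ↭-swap; ↭-sym)
open import Data.List.Relation.Binary.Permutation.Propositional.Properties using (∈-resp-↭; ↭-length; filter-↭; ++⁺ʳ)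
open import Data.List.Relation.Unary.Any using (here; there)
open import Data.List.Relation.Unary.All as All using (All; []; _∷_)
open import Data.List.Relation.Unary.AllPairs using (AllPairs; []; _∷_)
open import Data.List.Relation.Unary.Unique.Propositional using (Unique)
import Data.List.Relation.Unary.Unique.Propositional.Properties as Unique
open import Data.List.Relation.Unary.Unique.DecPropositional.Properties using (deduplicate-!)
open import Data.Product using (Σ; _×_; _,_; proj₁; proj₂; swap; uncurry)
open import Data.Sum using (_⊎_; inj₁; inj₂; [_,_])
open import Data.Empty using (⊥-elim)
open import Function using (_∘_; id)
open import Relation.Nullary using (¬_; yes; no)
open import Relation.Nullary.Decidable using (_⊎-dec_)
open import Relation.Binary.PropositionalEquality using (_≡_; _≢_; refl; sym; trans; cong; cong₂; ≢-sym; module ≡-Reasoning)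
open ≡-Reasoning

module _ {a} {A : Set a} where

  ++-injective : ∀ (xs xs′ : List A) {ys ys′} → length xs ≡ length xs′ →
                 xs ++ ys ≡ xs′ ++ ys′ → xs ≡ xs′ × ys ≡ ys′
  ++-injective []       []         _   eq = refl , eq
  ++-injective (x ∷ xs) (x′ ∷ xs′) len eq with ∷-injective eq
  ... | refl , eq′ with ++-injective xs xs′ (suc-injective len) eq′
  ... | refl , ys≡ys′ = refl , ys≡ys′

  ++-injective-suffix : ∀ (xs xs′ : List A) {ys ys′} → length ys ≡ length ys′ →
                  xs ++ ys ≡ xs′ ++ ys′ → xs ≡ xs′ × ys ≡ ys′
  ++-injective-suffix xs xs′ {ys} {ys′} len eq =
    ++-injective xs xs′ (+-cancelʳ-≡ (length ys) _ _ lengths) eq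
    where
    lengths : length xs + length ys ≡ length xs′ + length ys
    lengths = begin
      length xs + length ys    ≡⟨ length-++ xs ⟨
      length (xs ++ ys)        ≡⟨ cong length eq ⟩
      length (xs′ ++ ys′)      ≡⟨ length-++ xs′ ⟩
      length xs′ + length ys′  ≡⟨ cong (length xs′ +_) len ⟨
      length xs′ + length ys   ∎

  concatPairs : List (A × A) → List A
  concatPairs []            = []
  concatPairs ((p , q) ∷ I) = p ∷ q ∷ concatPairs I

  concatPairs-↭-swap : ∀ I → concatPairs I ↭ concatPairs (map swap I)
  concatPairs-↭-swap []            = ↭-refl
  concatPairs-↭-swap ((p , q) ∷ I) = ↭-swap p q (concatPairs-↭-swap I)

  All-concatPairs⁺ : ∀ {ℓ} {P : A → Set ℓ} {I} →
                     All (λ e → P (proj₁ e) × P (proj₂ e)) I → All P (concatPairs I)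
  All-concatPairs⁺ []                = []
  All-concatPairs⁺ ((Pp , Pq) ∷ PI) = Pp ∷ Pq ∷ All-concatPairs⁺ PI

module _ {n : ℕ} where

  open DecMembership (_≟_ {n}) using (_∈?_; _∉?_)

  count-resp-↭ : ∀ {u u′ : Word n} (a : Fin n) → u ↭ u′ → count a u ≡ count a u′
  count-resp-↭ a σ = ↭-length (filter-↭ (_≟ a) σ)

  Unique⇒OneUniform : ∀ {u : Word n} → Unique u → OneUniform u
  Unique⇒OneUniform {y ∷ ys} (y∉ys ∷ _) a (here refl)
    rewrite filter-accept (_≟ a) {x = y} {xs = ys} refl
          | filter-none (_≟ a) (All.map ≢-sym y∉ys) = refl
  Unique⇒OneUniform {y ∷ ys} (y∉ys ∷ ys!) a (there a∈ys)
    rewrite filter-reject (_≟ a) {x = y} {xs = ys} (All.lookup y∉ys a∈ys)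
    = Unique⇒OneUniform ys! a a∈ys

  OneUniform-resp-↭ : ∀ {u u′ : Word n} → u ↭ u′ → OneUniform u → OneUniform u′
  OneUniform-resp-↭ σ u-uniform a a∈u′ =
    trans (sym (count-resp-↭ a σ)) (u-uniform a (∈-resp-↭ (↭-sym σ) a∈u′))

  SameAlph-resp-↭ : ∀ {u u′ w : Word n} → u ↭ u′ → SameAlph u w → SameAlph u′ w
  SameAlph-resp-↭ σ same a =
    proj₁ (same a) ∘ ∈-resp-↭ (↭-sym σ) , ∈-resp-↭ σ ∘ proj₂ (same a)

  proj-++ : ∀ x y (u u′ : Word n) → proj x y (u ++ u′) ≡ proj x y u ++ proj x y u′
  proj-++ x y = filter-++ (λ z → (z ≟ x) ⊎-dec (z ≟ y))

  proj-∷-accept : ∀ {x y z} {u : Word n} → z ≡ x ⊎ z ≡ y → proj x y (z ∷ u) ≡ z ∷ proj x y u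
  proj-∷-accept {x} {y} = filter-accept (λ z → (z ≟ x) ⊎-dec (z ≟ y))

  proj-∷-reject : ∀ {x y z} {u : Word n} → ¬ (z ≡ x ⊎ z ≡ y) → proj x y (z ∷ u) ≡ proj x y u
  proj-∷-reject {x} {y} = filter-reject (λ z → (z ≟ x) ⊎-dec (z ≟ y))

  proj-swap-pair : ∀ {x y p q : Fin n} → p ≢ q → (x , y) ≢ (p , q) → (y , x) ≢ (p , q) →
                   proj x y (p ∷ q ∷ []) ≡ proj x y (q ∷ p ∷ [])
  proj-swap-pair {x} {y} {p} {q} p≢q xy≢pq yx≢pq
    with (p ≟ x) ⊎-dec (p ≟ y) | (q ≟ x) ⊎-dec (q ≟ y)
  ... | yes (inj₁ refl) | yes (inj₁ refl) = ⊥-elim (p≢q refl)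
  ... | yes (inj₁ refl) | yes (inj₂ refl) = ⊥-elim (xy≢pq refl)
  ... | yes (inj₂ refl) | yes (inj₁ refl) = ⊥-elim (yx≢pq refl)
  ... | yes (inj₂ refl) | yes (inj₂ refl) = ⊥-elim (p≢q refl)
  ... | yes p∈ | no q∉
    rewrite proj-∷-accept {u = q ∷ []} p∈ | proj-∷-reject {u = []} q∉
          | proj-∷-reject {u = p ∷ []} q∉ | proj-∷-accept {u = []} p∈ = refl
  ... | no p∉ | yes q∈
    rewrite proj-∷-reject {u = q ∷ []} p∉ | proj-∷-accept {u = []} q∈
          | proj-∷-accept {u = p ∷ []} q∈ | proj-∷-reject {u = []} p∉ = refl
  ... | no p∉ | no q∉
    rewrite proj-∷-reject {u = q ∷ []} p∉ | proj-∷-reject {u = []} q∉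
          | proj-∷-reject {u = p ∷ []} q∉ | proj-∷-reject {u = []} p∉ = refl

  proj-∷-injectiveˡ : ∀ {x y p q} {u u′ : Word n} → p ≡ x ⊎ p ≡ y → q ≡ x ⊎ q ≡ y →
                      proj x y (p ∷ u) ≡ proj x y (q ∷ u′) → p ≡ q
  proj-∷-injectiveˡ p∈ q∈ eq =
    ∷-injectiveˡ (trans (sym (proj-∷-accept p∈)) (trans eq (proj-∷-accept q∈)))

  proj-∷∷-cancel : ∀ {x y p q} {u u′ : Word n} → ¬ (p ≡ x ⊎ p ≡ y) → ¬ (q ≡ x ⊎ q ≡ y) →
                   proj x y (p ∷ q ∷ u) ≡ proj x y (q ∷ p ∷ u′) → proj x y u ≡ proj x y u′
  proj-∷∷-cancel {x} {y} {p} {q} {u} {u′} p∉ q∉ eq = begin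
    proj x y u            ≡⟨ proj-∷-reject q∉ ⟨
    proj x y (q ∷ u)      ≡⟨ proj-∷-reject p∉ ⟨
    proj x y (p ∷ q ∷ u)  ≡⟨ eq ⟩
    proj x y (q ∷ p ∷ u′) ≡⟨ proj-∷-reject q∉ ⟩
    proj x y (p ∷ u′)     ≡⟨ proj-∷-reject p∉ ⟩
    proj x y u′           ∎

  proj-concatPairs-swap : ∀ {x y} {I : List (Fin n × Fin n)} →
                          All (uncurry _≢_) I → ¬ InI I x y →
                          proj x y (concatPairs I) ≡ proj x y (concatPairs (map swap I))
  proj-concatPairs-swap {I = []} [] _ = refl
  proj-concatPairs-swap {x} {y} {(p , q) ∷ I} (p≢q ∷ loopless) xy∉I = begin
    proj x y (p ∷ q ∷ C)                 ≡⟨ proj-++ x y (p ∷ q ∷ []) C ⟩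
    proj x y (p ∷ q ∷ []) ++ proj x y C  ≡⟨ cong₂ _++_ swap-head swap-tail ⟩
    proj x y (q ∷ p ∷ []) ++ proj x y C′ ≡⟨ proj-++ x y (q ∷ p ∷ []) C′ ⟨
    proj x y (q ∷ p ∷ C′)                ∎
    where
    C C′ : Word n
    C  = concatPairs I
    C′ = concatPairs (map swap I)
    swap-head : proj x y (p ∷ q ∷ []) ≡ proj x y (q ∷ p ∷ [])
    swap-head = proj-swap-pair p≢q (xy∉I ∘ inj₁ ∘ here) (xy∉I ∘ inj₂ ∘ here)
    swap-tail : proj x y C ≡ proj x y C′
    swap-tail = proj-concatPairs-swap loopless (xy∉I ∘ [ inj₁ ∘ there , inj₂ ∘ there ])

  proj-concatPairs-swap-≢ : ∀ {x y} {I : List (Fin n × Fin n)} →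
                            x ≢ y → AllPairs Disjoint I → InI I x y →
                            proj x y (concatPairs I) ≢ proj x y (concatPairs (map swap I))
  proj-concatPairs-swap-≢ x≢y _ (inj₁ (here refl)) eq =
    x≢y (proj-∷-injectiveˡ (inj₁ refl) (inj₂ refl) eq)
  proj-concatPairs-swap-≢ x≢y _ (inj₂ (here refl)) eq =
    x≢y (proj-∷-injectiveˡ (inj₁ refl) (inj₂ refl) (sym eq))
  proj-concatPairs-swap-≢ x≢y (disjoint ∷ independent) (inj₁ (there xy∈I)) eq
    with All.lookup disjoint xy∈I
  ... | p≢x , p≢y , q≢x , q≢y =
    proj-concatPairs-swap-≢ x≢y independent (inj₁ xy∈I)
      (proj-∷∷-cancel [ p≢x , p≢y ] [ q≢x , q≢y ] eq)
  proj-concatPairs-swap-≢ x≢y (disjoint ∷ independent) (inj₂ (there yx∈I)) eq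
    with All.lookup disjoint yx∈I
  ... | p≢y , p≢x , q≢y , q≢x =
    proj-concatPairs-swap-≢ x≢y independent (inj₂ yx∈I)
      (proj-∷∷-cancel [ p≢x , p≢y ] [ q≢x , q≢y ] eq)

  proj-++-cancel : ∀ {x y} (w v : Word n) {u u′} →
                   u ↭ u′ → proj x y (w ++ u) ≡ proj x y (v ++ u′) →
                   proj x y w ≡ proj x y v × proj x y u ≡ proj x y u′
  proj-++-cancel {x} {y} w v {u} {u′} σ eq =
    ++-injective-suffix (proj x y w) (proj x y v) (↭-length (filter-↭ _ σ))
      (trans (sym (proj-++ x y w u)) (trans eq (proj-++ x y v u′)))

  proj-++-cong : ∀ {x y} (u u′ r r′ : Word n) →
                 proj x y u ≡ proj x y u′ → proj x y r ≡ proj x y r′ →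
                 proj x y (u ++ r) ≡ proj x y (u′ ++ r′)
  proj-++-cong {x} {y} u u′ r r′ eqᵤ eqᵣ = begin
    proj x y (u ++ r)          ≡⟨ proj-++ x y u r ⟩
    proj x y u ++ proj x y r   ≡⟨ cong₂ _++_ eqᵤ eqᵣ ⟩
    proj x y u′ ++ proj x y r′ ≡⟨ proj-++ x y u′ r′ ⟨
    proj x y (u′ ++ r′)        ∎

  Edge-++⁺ : ∀ (w v u u′ : Word n) {a b} → Edge w v a b → proj a b u ≡ proj a b u′ →
             Edge (w ++ u) (v ++ u′) a b
  Edge-++⁺ w v u u′ (a∈w , b∈w , a≢b , eq) eqᵤ =
    ∈-++⁺ˡ a∈w , ∈-++⁺ˡ b∈w , a≢b , proj-++-cong w v u u′ eq eqᵤ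

  Edge-++⁻ : ∀ (w v : Word n) {u u′ a b} → u ⊆ w → u ↭ u′ → Edge (w ++ u) (v ++ u′) a b →
             Edge w v a b × proj a b u ≡ proj a b u′
  Edge-++⁻ w v u⊆w σ (a∈ , b∈ , a≢b , eq) =
    let eqʷ , eqᵘ = proj-++-cancel w v σ eq in (from a∈ , from b∈ , a≢b , eqʷ) , eqᵘ
    where
    from : ∀ {z} → z ∈ w ++ _ → z ∈ w
    from = [ id , u⊆w ] ∘ ∈-++⁻ w

  concatPairs-unique : ∀ {I : List (Fin n × Fin n)} →
                       All (uncurry _≢_) I → AllPairs Disjoint I → Unique (concatPairs I)
  concatPairs-unique [] [] = []
  concatPairs-unique (p≢q ∷ loopless) (disjoint ∷ independent) =
    (p≢q ∷ All-concatPairs⁺ (All.map (λ (p≢c , p≢d , _ , _) → p≢c , p≢d) disjoint))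
    ∷ All-concatPairs⁺ (All.map (λ (_ , _ , q≢c , q≢d) → q≢c , q≢d) disjoint)
    ∷ concatPairs-unique loopless independent

  remaining : Word n → Word n → Word n
  remaining C w = filter (_∉? C) (deduplicate _≟_ w)

  module _ (C w : Word n) where

    remaining-⊆ : remaining C w ⊆ w
    remaining-⊆ = ∈-deduplicate⁻ _≟_ w ∘ proj₁ ∘ ∈-filter⁻ (_∉? C) {xs = deduplicate _≟_ w}

    ⊆-++-remaining : w ⊆ C ++ remaining C w
    ⊆-++-remaining {z} z∈w with z ∈? C
    ... | yes z∈C = ∈-++⁺ˡ z∈C
    ... | no  z∉C = ∈-++⁺ʳ C (∈-filter⁺ (_∉? C) (∈-deduplicate⁺ _≟_ z∈w) z∉C)

    ++-remaining-unique : Unique C → Unique (C ++ remaining C w)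
    ++-remaining-unique C! = Unique.++⁺ C! (Unique.filter⁺ (_∉? C) (deduplicate-! _≟_ w))
      (λ (z∈C , z∈R) → proj₂ (∈-filter⁻ (_∉? C) {xs = deduplicate _≟_ w} z∈R) z∈C)

    SameAlph-++-remaining : C ⊆ w → SameAlph (C ++ remaining C w) w
    SameAlph-++-remaining C⊆w z = [ C⊆w , remaining-⊆ ] ∘ ∈-++⁻ C , ⊆-++-remaining

theorem4 : ∀ {n} (w v : Word n) (I : List (Fin n × Fin n)) →
    SameAlph w v → IndependentEdgeSet w v I →
    Σ (Word n) λ uw → Σ (Word n) λ uv →
      OneUniform uw × OneUniform uv × SameAlph uw w × SameAlph uv w ×
      (∀ a b → (Edge (w ++ uw) (v ++ uv) a b → Edge w v a b × ¬ InI I a b)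
             × (Edge w v a b × ¬ InI I a b → Edge (w ++ uw) (v ++ uv) a b))
theorem4 {n} w v I _ (I⊆E , independent) =
  uw , uv , uw-uniform , OneUniform-resp-↭ uw↭uv uw-uniform ,
  uw-alph , SameAlph-resp-↭ uw↭uv uw-alph , λ _ _ → fwd , bwd
  where
  C C′ R uw uv : Word n
  C  = concatPairs I
  C′ = concatPairs (map swap I)
  R  = remaining C w
  uw = C ++ R
  uv = C′ ++ R

  uw↭uv : uw ↭ uv
  uw↭uv = ++⁺ʳ R (concatPairs-↭-swap I)

  loopless : All (uncurry _≢_) I
  loopless = All.tabulate λ pq∈I → proj₁ (proj₂ (proj₂ (I⊆E _ _ pq∈I)))

  C⊆w : C ⊆ w
  C⊆w = All.lookup (All-concatPairs⁺ (All.tabulate λ pq∈I →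
    let p∈w , q∈w , _ = I⊆E _ _ pq∈I in p∈w , q∈w))

  uw-uniform : OneUniform uw
  uw-uniform =
    Unique⇒OneUniform (++-remaining-unique C w (concatPairs-unique loopless independent))

  uw-alph : SameAlph uw w
  uw-alph = SameAlph-++-remaining C w C⊆w

  fwd : ∀ {a b} → Edge (w ++ uw) (v ++ uv) a b → Edge w v a b × ¬ InI I a b
  fwd e with Edge-++⁻ w v (proj₁ (uw-alph _)) uw↭uv e
  ... | e′@(_ , _ , a≢b , _) , eqᵘ =
    e′ , λ ab∈I →
      proj-concatPairs-swap-≢ a≢b independent ab∈I (proj₁ (proj-++-cancel C C′ ↭-refl eqᵘ))

  bwd : ∀ {a b} → Edge w v a b × ¬ InI I a b → Edge (w ++ uw) (v ++ uv) a b
  bwd (e , ab∉I) =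
    Edge-++⁺ w v uw uv e (proj-++-cong C C′ R R (proj-concatPairs-swap loopless ab∉I) refl)
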